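{- Let $n\ge 5$ and let $\hat d=((2n-2)^2,(n-1)^{n-2})$ (two entries equal to $2n-2$ and $n-2$ entries equal to $n-1$). Then $\mathrm{TotMult}(\hat d)=n-1$, and every loopless multigraph $H$ realizing $\hat d$ with $\mathrm{TotMult}(H)=\mathrm{TotMult}(\hat d)$ satisfies $\mathrm{MaxMult}(H)=n$.
   Context: Multigraphs are loopless (parallel edges allowed). $H$ realizes $d$ if its degree sequence equals $d$. For a multigraph $H=(V,E)$ with edge multiset $E$, $\mathrm{TotMult}(H)=|E|-|E'|$, where $E'$ is the edge set of its underlying simple graph, and $\mathrm{MaxMult}(H)$ is the maximum number of parallel copies of an edge between any two vertices. $\mathrm{TotMult}(d)$ is the minimum of $\mathrm{TotMult}(H)$ over all loopless multigraphs $H$ realizing $d$. -}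

module Defs where

open import Data.Nat using (ℕ; zero; suc; _+_; _*_; _∸_; _⊔_; _<?_; _≤_)
open import Data.Fin using (Fin; toℕ)
import Data.Fin as F
open import Data.Bool using (if_then_else_)
open import Relation.Nullary.Decidable using (⌊_⌋)
open import Relation.Binary.PropositionalEquality using (_≡_)
open import Data.Product using (Σ; _×_; _,_)

ΣFin : {n : ℕ} → (Fin n → ℕ) → ℕ
ΣFin {zero}  f = 0
ΣFin {suc n} f = f F.zero + ΣFin (λ i → f (F.suc i))

MaxFin : {n : ℕ} → (Fin n → ℕ) → ℕ
MaxFin {zero}  f = 0
MaxFin {suc n} f = f F.zero ⊔ MaxFin (λ i → f (F.suc i))

-- A loopless multigraph on vertex set Fin n, given by its multiplicity
-- function: mult u v = number of parallel edges between u and v.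
record Multigraph (n : ℕ) : Set where
  field
    mult      : Fin n → Fin n → ℕ
    symmetric : ∀ u v → mult u v ≡ mult v u
    loopless  : ∀ v → mult v v ≡ 0
open Multigraph public

degree : {n : ℕ} → Multigraph n → Fin n → ℕ
degree H v = ΣFin (λ u → mult H v u)

Realizes : {n : ℕ} → Multigraph n → (Fin n → ℕ) → Set
Realizes H d = ∀ v → degree H v ≡ d v

-- TotMult(H) = |E| - |E'| = Σ over unordered pairs {u,v} of (mult u v ∸ 1).
TotMult : {n : ℕ} → Multigraph n → ℕ
TotMult H = ΣFin (λ u → ΣFin (λ v →
  if ⌊ toℕ u <? toℕ v ⌋ then mult H u v ∸ 1 else 0))

MaxMult : {n : ℕ} → Multigraph n → ℕ
MaxMult H = MaxFin (λ u → MaxFin (λ v → mult H u v))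

IsTotMultSeq : {n : ℕ} → (Fin n → ℕ) → ℕ → Set
IsTotMultSeq {n} d k =
  (Σ (Multigraph n) λ H → Realizes H d × TotMult H ≡ k)
  × (∀ (H : Multigraph n) → Realizes H d → k ≤ TotMult H)

dhat : (n : ℕ) → Fin n → ℕ
dhat n i = if ⌊ toℕ i <? 2 ⌋ then 2 * n ∸ 2 else n ∸ 1

{-# OPTIONS --safe #-}
-- Write n = k + 2 and call the two vertices of degree 2(n − 1) the hubs. A hub has
-- degree 2(k + 1) but only k + 1 incident vertex pairs, so the surplus Σ (mult − 1)
-- over those pairs is at least k + 1. The surplus at hub₀ and the surplus on the
-- spokes of hub₁ live on disjoint pairs, so TotMult H ≥ (m − 1) + E₀ + E₁, where m is
-- the multiplicity between the hubs and Eᵢ the surplus on the spokes of hub i; since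
-- (m − 1) + Eᵢ ≥ k + 1 this gives TotMult H ≥ n − 1, and equality forces E₀ = E₁ = 0
-- and m = n. As every pair contributes mult − 1 ≤ TotMult H, no multiplicity exceeds n.
-- The bound is attained by joining the hubs by n parallel edges and each hub once to
-- every other vertex, the other vertices forming a complete graph.
module Submission where

open import Defs
open import Data.Nat using (ℕ; zero; suc; _+_; _*_; _∸_; _≤_; _<_; z≤n; s≤s; _<?_)
open import Data.Nat.Properties
open import Algebra.Properties.CommutativeSemigroup +-commutativeSemigroup using (x∙yz≈y∙xz)
open import Data.Fin using (Fin; zero; suc; toℕ)
open import Data.Fin.Properties using (toℕ-injective)
open import Data.Vec.Functional using (_∷_)
open import Data.Bool using (true; false; if_then_else_)
open import Data.Product using (_×_; _,_)
open import Relation.Binary using (tri<; tri≈; tri>)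
open import Relation.Binary.PropositionalEquality
  using (_≡_; refl; sym; trans; cong; cong₂; subst; module ≡-Reasoning)
open import Relation.Nullary.Decidable using (⌊_⌋; isYes≗does; dec-true)

f≤ΣFin : ∀ {k} (f : Fin k → ℕ) (i : Fin k) → f i ≤ ΣFin f
f≤ΣFin f zero    = m≤m+n _ _
f≤ΣFin f (suc i) = m≤n⇒m≤o+n (f zero) (f≤ΣFin (λ j → f (suc j)) i)

ΣFin-zero : ∀ {k} (f : Fin k → ℕ) → (∀ i → f i ≡ 0) → ΣFin f ≡ 0
ΣFin-zero {zero}  f f≡0 = refl
ΣFin-zero {suc k} f f≡0 = cong₂ _+_ (f≡0 zero) (ΣFin-zero (λ j → f (suc j)) (λ j → f≡0 (suc j)))

ΣFin-const : ∀ k c → ΣFin {k} (λ _ → c) ≡ k * c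
ΣFin-const zero    c = refl
ΣFin-const (suc k) c = cong (c +_) (ΣFin-const k c)

f≤MaxFin : ∀ {k} (f : Fin k → ℕ) (i : Fin k) → f i ≤ MaxFin f
f≤MaxFin f zero    = m≤m⊔n _ _
f≤MaxFin f (suc i) = m≤n⇒m≤o⊔n (f zero) (f≤MaxFin (λ j → f (suc j)) i)

MaxFin-lub : ∀ {k} (f : Fin k → ℕ) {b} → (∀ i → f i ≤ b) → MaxFin f ≤ b
MaxFin-lub {zero}  f f≤b = z≤n
MaxFin-lub {suc k} f f≤b = ⊔-lub (f≤b zero) (MaxFin-lub (λ j → f (suc j)) (λ j → f≤b (suc j)))

excess : ∀ {k} → (Fin k → ℕ) → ℕ
excess f = ΣFin (λ i → f i ∸ 1)

ΣFin≤size+excess : ∀ {k} (f : Fin k → ℕ) → ΣFin f ≤ k + excess f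
ΣFin≤size+excess {zero}  f = z≤n
ΣFin≤size+excess {suc k} f = begin
  f zero + ΣFin f′                   ≤⟨ +-mono-≤ (m≤n+m∸n (f zero) 1) (ΣFin≤size+excess f′) ⟩
  suc (f zero ∸ 1) + (k + excess f′) ≡⟨ cong suc (x∙yz≈y∙xz (f zero ∸ 1) k (excess f′)) ⟩
  suc k + excess f                   ∎
  where
  open ≤-Reasoning
  f′ : Fin k → ℕ
  f′ j = f (suc j)

doubled-degree-excess : ∀ {k} (f : Fin (suc k) → ℕ) → ΣFin f ≡ suc k + suc k → suc k ≤ excess f
doubled-degree-excess {k} f Σf≡ = +-cancelˡ-≤ (suc k) _ _ (begin
  suc k + suc k    ≡⟨ Σf≡ ⟨
  ΣFin f           ≤⟨ ΣFin≤size+excess f ⟩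
  suc k + excess f ∎)
  where open ≤-Reasoning

2*n∸2≡n∸1+n∸1 : ∀ n → 2 * n ∸ 2 ≡ (n ∸ 1) + (n ∸ 1)
2*n∸2≡n∸1+n∸1 zero    = refl
2*n∸2≡n∸1+n∸1 (suc m) = trans (cong (_∸ 1) (+-suc m (m + 0))) (cong (m +_) (+-identityʳ m))

m+n+o≤p⇒p≤m+n⇒p≤m+o⇒m≡p : ∀ m n o p → m + n + o ≤ p → p ≤ m + n → p ≤ m + o → m ≡ p
m+n+o≤p⇒p≤m+n⇒p≤m+o⇒m≡p m n o p m+n+o≤p p≤m+n p≤m+o = ≤-antisym m≤p p≤m
  where
  m≤p : m ≤ p
  m≤p = ≤-trans (≤-trans (m≤m+n m n) (m≤m+n (m + n) o)) m+n+o≤p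
  o≡0 : o ≡ 0
  o≡0 = n≤0⇒n≡0 (+-cancelˡ-≤ (m + n) o 0 (≤-trans m+n+o≤p (subst (p ≤_) (sym (+-identityʳ _)) p≤m+n)))
  p≤m : p ≤ m
  p≤m = subst (p ≤_) (trans (cong (m +_) o≡0) (+-identityʳ m)) p≤m+o

m∸1≡1+n⇒m≡2+n : ∀ {m n} → m ∸ 1 ≡ suc n → m ≡ suc (suc n)
m∸1≡1+n⇒m≡2+n {suc m} m∸1≡1+n = cong suc m∸1≡1+n

module _ {n : ℕ} (H : Multigraph n) where

  mult∸1≤TotMult : ∀ u v → toℕ u < toℕ v → mult H u v ∸ 1 ≤ TotMult H
  mult∸1≤TotMult u v u<v = begin
    mult H u v ∸ 1    ≡⟨ cong (if_then mult H u v ∸ 1 else 0) ⌊u<?v⌋≡true ⟨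
    pairTerm u v      ≤⟨ f≤ΣFin (pairTerm u) v ⟩
    ΣFin (pairTerm u) ≤⟨ f≤ΣFin (λ w → ΣFin (pairTerm w)) u ⟩
    TotMult H         ∎
    where
    open ≤-Reasoning
    ⌊u<?v⌋≡true : ⌊ toℕ u <? toℕ v ⌋ ≡ true
    ⌊u<?v⌋≡true = trans (isYes≗does (toℕ u <? toℕ v)) (dec-true (toℕ u <? toℕ v) u<v)
    pairTerm : Fin n → Fin n → ℕ
    pairTerm u v = if ⌊ toℕ u <? toℕ v ⌋ then mult H u v ∸ 1 else 0

  mult≤1+TotMult : ∀ u v → mult H u v ≤ suc (TotMult H)
  mult≤1+TotMult u v with <-cmp (toℕ u) (toℕ v)
  ... | tri< u<v _ _ = ≤-trans (m≤n+m∸n _ 1) (s≤s (mult∸1≤TotMult u v u<v))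
  ... | tri≈ _ u≡v _ rewrite toℕ-injective u≡v | loopless H v = z≤n
  ... | tri> _ _ v<u rewrite symmetric H u v = ≤-trans (m≤n+m∸n _ 1) (s≤s (mult∸1≤TotMult v u v<u))

  MaxMult≤1+TotMult : MaxMult H ≤ suc (TotMult H)
  MaxMult≤1+TotMult = MaxFin-lub _ (λ u → MaxFin-lub _ (mult≤1+TotMult u))

  mult≤MaxMult : ∀ u v → mult H u v ≤ MaxMult H
  mult≤MaxMult u v = ≤-trans (f≤MaxFin (mult H u) v) (f≤MaxFin (λ w → MaxFin (mult H w)) u)

completeMult : ∀ {k} → Fin k → Fin k → ℕ
completeMult zero    = 0 ∷ λ _ → 1
completeMult (suc u) = 1 ∷ completeMult u

complete : (k : ℕ) → Multigraph k
complete k = record { mult = completeMult ; symmetric = sym′ ; loopless = loopless′ }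
  where
  sym′ : ∀ {k} (u v : Fin k) → completeMult u v ≡ completeMult v u
  sym′ zero    zero    = refl
  sym′ zero    (suc v) = refl
  sym′ (suc u) zero    = refl
  sym′ (suc u) (suc v) = sym′ u v
  loopless′ : ∀ {k} (u : Fin k) → completeMult u u ≡ 0
  loopless′ zero    = refl
  loopless′ (suc u) = loopless′ u

completeMult≤1 : ∀ {k} (u v : Fin k) → completeMult u v ≤ 1
completeMult≤1 zero    zero    = z≤n
completeMult≤1 zero    (suc v) = ≤-refl
completeMult≤1 (suc u) zero    = ≤-refl
completeMult≤1 (suc u) (suc v) = completeMult≤1 u v

1+degree-complete : ∀ {k} (u : Fin k) → suc (degree (complete k) u) ≡ k
1+degree-complete {suc k} zero    = cong suc (trans (ΣFin-const k 1) (*-identityʳ k))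
1+degree-complete {suc k} (suc u) = cong suc (1+degree-complete u)

module HubGraph (k : ℕ) where

  hubMult : Fin (suc (suc k)) → Fin (suc (suc k)) → ℕ
  hubMult zero          = 0 ∷ suc (suc k) ∷ λ _ → 1
  hubMult (suc zero)    = suc (suc k) ∷ 0 ∷ λ _ → 1
  hubMult (suc (suc u)) = 1 ∷ 1 ∷ completeMult u

  hubGraph : Multigraph (suc (suc k))
  hubGraph = record { mult = hubMult ; symmetric = sym′ ; loopless = loopless′ }
    where
    sym′ : ∀ u v → hubMult u v ≡ hubMult v u
    sym′ zero          zero          = refl
    sym′ zero          (suc zero)    = refl
    sym′ zero          (suc (suc v)) = refl
    sym′ (suc zero)    zero          = refl
    sym′ (suc zero)    (suc zero)    = refl
    sym′ (suc zero)    (suc (suc v)) = refl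
    sym′ (suc (suc u)) zero          = refl
    sym′ (suc (suc u)) (suc zero)    = refl
    sym′ (suc (suc u)) (suc (suc v)) = symmetric (complete k) u v
    loopless′ : ∀ u → hubMult u u ≡ 0
    loopless′ zero          = refl
    loopless′ (suc zero)    = refl
    loopless′ (suc (suc u)) = loopless (complete k) u

  hub-degree : suc (suc (k + ΣFin {k} (λ _ → 1))) ≡ 2 * suc (suc k) ∸ 2
  hub-degree = begin
    suc (suc (k + ΣFin {k} (λ _ → 1)))
      ≡⟨ cong (λ s → suc (suc (k + s))) (trans (ΣFin-const k 1) (*-identityʳ k)) ⟩
    suc (suc (k + k))   ≡⟨ cong suc (+-suc k k) ⟨
    suc k + suc k       ≡⟨ 2*n∸2≡n∸1+n∸1 (suc (suc k)) ⟨
    2 * suc (suc k) ∸ 2 ∎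
    where open ≡-Reasoning

  hubGraph-realizes : Realizes hubGraph (dhat (suc (suc k)))
  hubGraph-realizes zero          = hub-degree
  hubGraph-realizes (suc zero)    = hub-degree
  hubGraph-realizes (suc (suc u)) = cong suc (1+degree-complete u)

  TotMult-hubGraph : TotMult hubGraph ≡ suc k
  TotMult-hubGraph = cong suc (begin
    k + ΣFin {k} (λ _ → 0) + ΣFin (λ u → ΣFin (pairTerm (suc u)))
      ≡⟨ cong₂ (λ a b → k + a + b) (ΣFin-zero {k} _ (λ _ → refl))
                                   (ΣFin-zero _ (λ u → ΣFin-zero _ (pairTerm≡0 u))) ⟩
    k + 0 + 0
      ≡⟨ trans (+-identityʳ _) (+-identityʳ k) ⟩
    k ∎)
    where
    open ≡-Reasoning
    pairTerm : Fin (suc (suc k)) → Fin (suc (suc k)) → ℕ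
    pairTerm u v = if ⌊ toℕ u <? toℕ v ⌋ then hubMult u v ∸ 1 else 0
    if-then-0 : ∀ b {x} → x ≡ 0 → (if b then x else 0) ≡ 0
    if-then-0 true  x≡0 = x≡0
    if-then-0 false x≡0 = refl
    pairTerm≡0 : ∀ u v → pairTerm (suc u) v ≡ 0
    pairTerm≡0 zero    zero          = refl
    pairTerm≡0 zero    (suc zero)    = refl
    pairTerm≡0 zero    (suc (suc v)) = refl
    pairTerm≡0 (suc u) zero          = refl
    pairTerm≡0 (suc u) (suc zero)    = refl
    pairTerm≡0 (suc u) (suc (suc v)) = if-then-0 _ (m≤n⇒m∸n≡0 (completeMult≤1 u v))

hub₀ hub₁ : ∀ {k} → Fin (suc (suc k))
hub₀ = zero
hub₁ = suc zero

module Hubs {k : ℕ} (H : Multigraph (suc (suc k))) where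

  spokes₀ spokes₁ : Fin k → ℕ
  spokes₀ i = mult H hub₀ (suc (suc i))
  spokes₁ i = mult H hub₁ (suc (suc i))

  star₀ star₁ : Fin (suc k) → ℕ
  star₀ = mult H hub₀ hub₁ ∷ spokes₀
  star₁ = mult H hub₀ hub₁ ∷ spokes₁

  -- star₀ and spokes₁ cover disjoint pairs, and TotMult H unfolds to their surplus first.
  excess-stars≤TotMult : excess star₀ + excess spokes₁ ≤ TotMult H
  excess-stars≤TotMult = +-monoʳ-≤ (excess star₀) (m≤m+n _ _)

  degree-hub₀ : degree H hub₀ ≡ ΣFin star₀
  degree-hub₀ = cong (_+ ΣFin star₀) (loopless H hub₀)

  degree-hub₁ : degree H hub₁ ≡ ΣFin star₁
  degree-hub₁ = cong₂ _+_ (symmetric H hub₁ hub₀) (cong (_+ ΣFin spokes₁) (loopless H hub₁))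

  module _ (realizes : Realizes H (dhat (suc (suc k)))) where

    1+k≤excess-star₀ : suc k ≤ excess star₀
    1+k≤excess-star₀ = doubled-degree-excess star₀
      (trans (sym degree-hub₀) (trans (realizes hub₀) (2*n∸2≡n∸1+n∸1 (suc (suc k)))))

    1+k≤excess-star₁ : suc k ≤ excess star₁
    1+k≤excess-star₁ = doubled-degree-excess star₁
      (trans (sym degree-hub₁) (trans (realizes hub₁) (2*n∸2≡n∸1+n∸1 (suc (suc k)))))

    1+k≤TotMult : suc k ≤ TotMult H
    1+k≤TotMult = ≤-trans 1+k≤excess-star₀ (≤-trans (m≤m+n _ _) excess-stars≤TotMult)

    TotMult≡1+k⇒hubMult≡2+k : TotMult H ≡ suc k → mult H hub₀ hub₁ ≡ suc (suc k)
    TotMult≡1+k⇒hubMult≡2+k tot = m∸1≡1+n⇒m≡2+n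
      (m+n+o≤p⇒p≤m+n⇒p≤m+o⇒m≡p _ _ _ _
        (subst (excess star₀ + excess spokes₁ ≤_) tot excess-stars≤TotMult) 1+k≤excess-star₀ 1+k≤excess-star₁)

lemma13 : (n : ℕ) → 5 ≤ n →
    IsTotMultSeq (dhat n) (n ∸ 1)
    × (∀ (H : Multigraph n) → Realizes H (dhat n) → TotMult H ≡ n ∸ 1 →
        MaxMult H ≡ n)
lemma13 (suc (suc k)) (s≤s (s≤s _)) =
  ((hubGraph , hubGraph-realizes , TotMult-hubGraph) , 1+k≤TotMult)
  , λ H realizes tot → ≤-antisym
      (subst (MaxMult H ≤_) (cong suc tot) (MaxMult≤1+TotMult H))
      (subst (_≤ MaxMult H) (TotMult≡1+k⇒hubMult≡2+k H realizes tot) (mult≤MaxMult H hub₀ hub₁))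
  where
  open HubGraph k
  open Hubs
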